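{- Let $V$ be a non-empty finite set and $R$ a monotone pyramidal transit function on $V$, pyramidal with respect to a total order $<$ on $V$, and suppose $R$ satisfies (b3) or (b4), where (b3): if $x\in R(u,v)$ and $y\in R(u,x)$, then $x\in R(y,v)$; (b4): if $x\in R(u,v)$, then $R(u,x)\cap R(x,v)=\{x\}$. Then $R(u,v)=[u,v]$ for all $u,v\in V$, where $[u,v]=\{w\in V\mid u\le w\le v\}$ is the interval with respect to $<$.
   Context: A transit function on $V$ is a map $R:V\times V\to 2^V$ with $u\in R(u,v)$, $R(u,v)=R(v,u)$, $R(u,u)=\{u\}$ for all $u,v\in V$; it is monotone if $p,q\in R(u,v)$ implies $R(p,q)\subseteq R(u,v)$. $R$ is pyramidal with respect to the total order $<$ if the transit sets $\{R(x,y)\mid x,y\in V\}$ are closed under non-empty intersection and each $R(x,y)$ is an interval w.r.t. $<$ (if $a,b\in R(x,y)$ and $a<w<b$ then $w\in R(x,y)$). By symmetry of $R$, $[u,v]$ for $u>v$ is read as $[v,u]$. -}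

module Defs where

open import Level using (0ℓ)
open import Data.Nat using (ℕ)
open import Data.Fin using (Fin)
open import Data.Product using (Σ; ∃; _×_; _,_)
open import Data.Sum using (_⊎_)
open import Relation.Binary.PropositionalEquality using (_≡_)
open import Relation.Unary using (Pred; _∈_; _⊆_; _∩_; _≐_; ｛_｝)

TransitMap : Set → Set₁
TransitMap V = V → V → Pred V 0ℓ

record IsTransit {V : Set} (R : TransitMap V) : Set where
  field
    t1 : ∀ u v → u ∈ R u v
    t2 : ∀ u v → R u v ≐ R v u
    t3 : ∀ u → R u u ≐ ｛ u ｝

IsMonotone : {V : Set} → TransitMap V → Set
IsMonotone {V} R = ∀ u v p q → p ∈ R u v → q ∈ R u v → R p q ⊆ R u v

_≤[_]_ : {V : Set} → V → (V → V → Set) → V → Set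
a ≤[ _<_ ] b = (a < b) ⊎ (a ≡ b)

IsConvex : {V : Set} → (V → V → Set) → Pred V 0ℓ → Set
IsConvex {V} _<_ S = ∀ a b w → a ∈ S → b ∈ S → a < w → w < b → w ∈ S

ClosedUnderNonEmptyIntersection : {V : Set} → TransitMap V → Set
ClosedUnderNonEmptyIntersection {V} R =
  ∀ x y x′ y′ → (∃ λ w → w ∈ (R x y ∩ R x′ y′)) →
  ∃ λ a → ∃ λ b → R a b ≐ (R x y ∩ R x′ y′)

IsPyramidal : {V : Set} → (V → V → Set) → TransitMap V → Set
IsPyramidal _<_ R =
  ClosedUnderNonEmptyIntersection R × (∀ x y → IsConvex _<_ (R x y))

B3 : {V : Set} → TransitMap V → Set
B3 R = ∀ u v x y → x ∈ R u v → y ∈ R u x → x ∈ R y v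

B4 : {V : Set} → TransitMap V → Set
B4 R = ∀ u v x → x ∈ R u v → (R u x ∩ R x v) ≐ ｛ x ｝

-- The interval [u,v] w.r.t. _<_, read as [v,u] when v < u.
Interval : {V : Set} → (V → V → Set) → V → V → Pred V 0ℓ
Interval _<_ u v w =
  (u ≤[ _<_ ] w × w ≤[ _<_ ] v) ⊎ (v ≤[ _<_ ] w × w ≤[ _<_ ] u)

{-# OPTIONS --safe #-}
module Submission where

-- Only the convexity of the transit sets and (b3)/(b4) are needed. Since u and v lie in R(u,v), convexity gives
-- [u,v] ⊆ R(u,v). Conversely, (b3) and (b4) both forbid "overshooting": w ∈ R(a,c) and
-- c ∈ R(a,w) force w = c. If some w ∈ R(u,v) lay beyond v, convexity of R(u,w) would put
-- v in R(u,w), an overshoot; likewise beyond u.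

open import Defs
open import Data.Nat using (ℕ; suc)
open import Data.Fin using (Fin)
open import Data.Sum using (_⊎_; inj₁; inj₂; [_,_])
open import Data.Product using (_×_; _,_; proj₁; proj₂)
open import Data.Empty using (⊥-elim)
open import Relation.Binary.PropositionalEquality using (_≡_; refl; sym)
open import Relation.Binary.Structures using (IsStrictTotalOrder)
open import Relation.Binary.Definitions using (tri<; tri≈; tri>)
open import Relation.Unary using (_∈_; _⊆_; _≐_)

NoOvershoot : {V : Set} → TransitMap V → Set
NoOvershoot R = ∀ a c w → w ∈ R a c → c ∈ R a w → w ≡ c

module _ {V : Set} {R : TransitMap V} (tr : IsTransit R) where
  open IsTransit tr

  right∈ : ∀ u v → v ∈ R u v
  right∈ u v = proj₁ (t2 v u) (t1 v u)

  B3⇒NoOvershoot : B3 R → NoOvershoot R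
  B3⇒NoOvershoot b3 a c w w∈Rac c∈Raw = sym (proj₁ (t3 c) (b3 a c w c w∈Rac c∈Raw))

  B4⇒NoOvershoot : B4 R → NoOvershoot R
  B4⇒NoOvershoot b4 a c w w∈Rac c∈Raw = sym (proj₁ (b4 a w c c∈Raw) (w∈Rac , right∈ c w))

  module _ {_<_ : V → V → Set} (convex : ∀ x y → IsConvex _<_ (R x y)) where

    ≤-between-endpoints⇒∈ : ∀ u v {w} → u ≤[ _<_ ] w → w ≤[ _<_ ] v → w ∈ R u v
    ≤-between-endpoints⇒∈ u v (inj₂ refl) _          = t1 u v
    ≤-between-endpoints⇒∈ u v (inj₁ _)    (inj₂ refl) = right∈ u v
    ≤-between-endpoints⇒∈ u v (inj₁ u<w)  (inj₁ w<v)  =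
      convex u v u v _ (t1 u v) (right∈ u v) u<w w<v

    interval⊆R : ∀ u v → Interval _<_ u v ⊆ R u v
    interval⊆R u v (inj₁ (u≤w , w≤v)) = ≤-between-endpoints⇒∈ u v u≤w w≤v
    interval⊆R u v (inj₂ (v≤w , w≤u)) = proj₁ (t2 v u) (≤-between-endpoints⇒∈ v u v≤w w≤u)

    module _ (sto : IsStrictTotalOrder _≡_ _<_) (noOvershoot : NoOvershoot R) where
      open IsStrictTotalOrder sto using (compare; irrefl)

      ∈⇒≤-right : ∀ {u v w} → u < v → w ∈ R u v → w ≤[ _<_ ] v
      ∈⇒≤-right {u} {v} {w} u<v w∈Ruv with compare w v
      ... | tri< w<v _ _ = inj₁ w<v
      ... | tri≈ _ w≡v _ = inj₂ w≡v
      ... | tri> _ _ v<w = ⊥-elim (irrefl (sym (noOvershoot u v w w∈Ruv v∈Ruw)) v<w)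
        where v∈Ruw = convex u w u w v (t1 u w) (right∈ u w) u<v v<w

      ∈⇒≤-left : ∀ {u v w} → u < v → w ∈ R u v → u ≤[ _<_ ] w
      ∈⇒≤-left {u} {v} {w} u<v w∈Ruv with compare u w
      ... | tri< u<w _ _ = inj₁ u<w
      ... | tri≈ _ u≡w _ = inj₂ u≡w
      ... | tri> _ _ w<u = ⊥-elim (irrefl (noOvershoot v u w (proj₁ (t2 u v) w∈Ruv) u∈Rvw) w<u)
        where u∈Rvw = convex v w w v u (right∈ v w) (t1 v w) w<u u<v

      ∈⇒between-< : ∀ {u v w} → u < v → w ∈ R u v → u ≤[ _<_ ] w × w ≤[ _<_ ] v
      ∈⇒between-< u<v w∈Ruv = ∈⇒≤-left u<v w∈Ruv , ∈⇒≤-right u<v w∈Ruv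

      R⊆interval : ∀ u v → R u v ⊆ Interval _<_ u v
      R⊆interval u v {w} w∈Ruv with compare u v
      ... | tri< u<v _ _ = inj₁ (∈⇒between-< u<v w∈Ruv)
      ... | tri≈ _ refl _ = inj₁ (inj₂ u≡w , inj₂ (sym u≡w))
        where u≡w = proj₁ (t3 u) w∈Ruv
      ... | tri> _ _ v<u = inj₂ (∈⇒between-< v<u (proj₁ (t2 u v) w∈Ruv))

mainTheorem5 : (n : ℕ) (_<_ : Fin (suc n) → Fin (suc n) → Set)
    → IsStrictTotalOrder _≡_ _<_
    → (R : TransitMap (Fin (suc n)))
    → IsTransit R → IsMonotone R → IsPyramidal _<_ R
    → B3 R ⊎ B4 R
    → ∀ u v → R u v ≐ Interval _<_ u v
mainTheorem5 n _<_ sto R tr _ (_ , convex) b3⊎b4 u v =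
  R⊆interval tr convex sto noOvershoot u v , interval⊆R tr convex u v
  where
  noOvershoot : NoOvershoot R
  noOvershoot = [ B3⇒NoOvershoot tr , B4⇒NoOvershoot tr ] b3⊎b4
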